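{- Parallel coherence does not generalize parallel independence: there exist a signature $\Sigma$, a finite set of rules $\mathcal{R}$, an attributed graph $G$ and a set $M\subseteq\mathrm{Match}_{\mathcal{R}}(G)$ such that $M$ is parallel independent but $M$ is not parallel coherent.
   Context: Fix a many-sorted signature $\Sigma$ and a set $\mathscr{V}$ of sorted variables disjoint from $\Sigma$; $T_\Sigma(X)$ is the term algebra over a finite $X\subseteq\mathscr{V}$, and $|\mathcal{A}|$ denotes the disjoint union of the carriers of a $\Sigma$-algebra $\mathcal{A}$. An attributed graph $G=(V_G,A_G,s_G,t_G,\mathcal{A}_G,l_G)$ consists of sets $V_G$ (vertices) and $A_G$ (arrows), source and target functions $s_G,t_G:A_G\to V_G$, a $\Sigma$-algebra $\mathcal{A}_G$, and an attribution $l_G:V_G\cup A_G\to\mathcal{P}(|\mathcal{A}_G|)$, with $V_G,A_G,|\mathcal{A}_G|$ pairwise disjoint. $H\lhd G$ ($H$ is a subgraph of $G$) if $V_H\subseteq V_G$, $A_H\subseteq A_G$, $s_H,t_H$ are restrictions of $s_G,t_G$, $\mathcal{A}_H=\mathcal{A}_G$, and $l_H(x)\subseteq l_G(x)$ for all $x\in V_H\cup A_H$. A morphism $\alpha:H\to G$ is a function from $V_H\cup A_H\cup|\mathcal{A}_H|$ to $V_G\cup A_G\cup|\mathcal{A}_G|$ mapping vertices to vertices and arrows to arrows with $s_G\circ\alpha=\alpha\circ s_H$, $t_G\circ\alpha=\alpha\circ t_H$, whose restriction $\alpha_{\mathcal{A}}$ to $|\mathcal{A}_H|$ is a $\Sigma$-homomorphism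 into $\mathcal{A}_G$, and with $\alpha_{\mathcal{A}}(l_H(x))\subseteq l_G(\alpha(x))$. For $F\lhd H$, $\alpha(F)$ is the smallest subgraph of $G$ such that $\alpha$ restricted to $F$ is a morphism $F\to\alpha(F)$. A matching is a morphism injective on vertices and arrows. Graphs $H,G$ are joinable if $\mathcal{A}_H=\mathcal{A}_G$, $V_H\cap A_G=A_H\cap V_G=\varnothing$, and $s_H,s_G$ (resp. $t_H,t_G$) agree on $A_H\cap A_G$; then $H\sqcap G$ has vertices $V_H\cap V_G$, arrows $A_H\cap A_G$, the common source/target maps, algebra $\mathcal{A}_H$ and attribution $l_H\cap l_G$, and $H\sqcup G$ has vertices $V_H\cup V_G$, arrows $A_H\cup A_G$, the joined source/target maps, algebra $\mathcal{A}_H$ and attribution $l_H\cup l_G$. A $(\Sigma,X)$-graph is a finite graph with algebra $T_\Sigma(X)$. A rule is a triple $r=(L,K,R)$ of $(\Sigma,X)$-graphs with $L,R$ joinable, $L\sqcap R\lhd K\lhd L$, and $X$ equal to the set of variables occurring in attributes of $L$. A matching of $r$ in $G$ is a matching $\mu:L\to G$ that is consistent: $\mu_{\mathcal{A}}(l_L(x)\setminus l_K(x))\cap\mu_{\mathcal{A}}(l_K(x))=\varnothing$ for all $x\in V_K\cup A_K$. $\mathcal{R}$ is a finite set of rules whose distinct members have distinct left-hand-side carriers; $\mathrm{Match}_{\mathcal{R}}(G)$ is the (disjoint) union of the sets of matchings of its rules in $G$, and for $\mu\in\mathrm{Match}_{\mathcal{R}}(G)$ its rule is written $(L_\mu,K_\mu,R_\mu)$.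 For such $\mu$ define $\mu^{\uparrow}$ on $R_\mu$: it equals $\mu_{\mathcal{A}}$ on the algebra, $\mu^{\uparrow}(x)=\mu(x)$ if $x\in V_{K_\mu}\cup A_{K_\mu}$, and $\mu^{\uparrow}(x)=(x,\mu)$ (a fresh item) otherwise; $\mu^{\uparrow}(R_\mu)$ is the graph with vertices $\mu(V_{R_\mu}\cap V_{K_\mu})\cup((V_{R_\mu}\setminus V_{K_\mu})\times\{\mu\})$, arrows defined similarly, source $\mu^{\uparrow}\circ s_{R_\mu}\circ(\mu^{\uparrow})^{ -1}$, target likewise, algebra $\mathcal{A}_G$, attribution $\mu_{\mathcal{A}}\circ l_{R_\mu}\circ(\mu^{\uparrow})^{ -1}$. For $M\subseteq\mathrm{Match}_{\mathcal{R}}(G)$: $M$ is parallel independent if $(\nu(L_\nu)\sqcup\nu^{\uparrow}(R_\nu))\sqcap\mu(L_\mu)\lhd\mu(K_\mu)\sqcup\mu^{\uparrow}(R_\mu)$ for all $\mu,\nu\in M$ with $\mu\neq\nu$; $M$ is parallel coherent if $\nu(R_\nu\sqcap K_\nu)\sqcap\mu(L_\mu)\lhd\mu(K_\mu)$ for all $\mu,\nu\in M$. -}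

module Defs where

open import Data.Bool using (Bool; true; T)
open import Data.Nat using (ℕ)
open import Data.Fin using (Fin)
open import Data.List using (List; []; _∷_; _++_)
open import Data.List.Relation.Unary.All as All using (All; []; _∷_)
open import Data.List.Membership.Propositional using (_∈_)
open import Data.Product using (Σ; Σ-syntax; _×_; _,_; proj₁; proj₂)
open import Data.Sum using (_⊎_; inj₁; inj₂)
open import Data.Empty using (⊥)
open import Relation.Nullary using (¬_)
open import Relation.Binary.PropositionalEquality using (_≡_; _≢_)
open import Function.Bundles using (_⇔_)

-- A many-sorted signature Σ together with a set 𝒱 of sorted variables
-- (disjointness of 𝒱 from Σ is automatic: they live in different types).

record Sig : Set₁ where
  field
    Sort  : Set
    Op    : Set
    arity : Op → List Sort
    res   : Op → Sort
    Var   : Set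
    vsort : Var → Sort
open Sig public

record Algebra (𝕊 : Sig) : Set₁ where
  field
    Carrier : Sort 𝕊 → Set
    apply   : (o : Op 𝕊) → All Carrier (arity 𝕊 o) → Carrier (res 𝕊 o)
open Algebra public

∣_∣ : {𝕊 : Sig} → Algebra 𝕊 → Set
∣_∣ {𝕊} 𝒜 = Σ (Sort 𝕊) (Carrier 𝒜)

record Hom {𝕊 : Sig} (𝒜 ℬ : Algebra 𝕊) : Set where
  field
    fun  : ∀ {s} → Carrier 𝒜 s → Carrier ℬ s
    pres : (o : Op 𝕊) (xs : All (Carrier 𝒜) (arity 𝕊 o)) →
           fun (apply 𝒜 o xs) ≡ apply ℬ o (All.map fun xs)
open Hom public

homU : {𝕊 : Sig} {𝒜 ℬ : Algebra 𝕊} → Hom 𝒜 ℬ → ∣ 𝒜 ∣ → ∣ ℬ ∣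
homU h (s , c) = s , fun h c

module _ {𝕊 : Sig} where

  data Term (X : Var 𝕊 → Bool) : Sort 𝕊 → Set where
    var : (v : Var 𝕊) → T (X v) → Term X (vsort 𝕊 v)
    op  : (o : Op 𝕊) → All (Term X) (arity 𝕊 o) → Term X (res 𝕊 o)

  mutual
    vars : {X : Var 𝕊 → Bool} {s : Sort 𝕊} → Term X s → List (Var 𝕊)
    vars (var v _) = v ∷ []
    vars (op o ts) = varsAll ts

    varsAll : {X : Var 𝕊 → Bool} {ss : List (Sort 𝕊)} → All (Term X) ss → List (Var 𝕊)
    varsAll []       = []
    varsAll (t ∷ ts) = vars t ++ varsAll ts

TermAlg : (𝕊 : Sig) → (Var 𝕊 → Bool) → Algebra 𝕊
TermAlg 𝕊 X = record { Carrier = Term {𝕊} X ; apply = op }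

-- Items (vertices/arrows) live in an ambient type I;
-- V, A are the vertex and arrow sets, the source and target functions are
-- given by their graphs (src a v  means  s(a) = v), the attribution by
-- l x : 𝒫(|𝒜|).

record Graph {𝕊 : Sig} (I : Set) (𝒜 : Algebra 𝕊) : Set₁ where
  field
    V   : I → Set
    A   : I → Set
    src : I → I → Set
    tgt : I → I → Set
    l   : I → ∣ 𝒜 ∣ → Set
open Graph public

module _ {𝕊 : Sig} {I : Set} {𝒜 : Algebra 𝕊} where

  Item : Graph I 𝒜 → I → Set
  Item G x = V G x ⊎ A G x

  record IsAttrGraph (G : Graph I 𝒜) : Set where
    field
      VA-disj : ∀ x → V G x → A G x → ⊥
      src-dom : ∀ a v → src G a v → A G a × V G v
      src-tot : ∀ a → A G a → Σ I (src G a)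
      src-fun : ∀ a v w → src G a v → src G a w → v ≡ w
      tgt-dom : ∀ a v → tgt G a v → A G a × V G v
      tgt-tot : ∀ a → A G a → Σ I (tgt G a)
      tgt-fun : ∀ a v w → tgt G a v → tgt G a w → v ≡ w
      l-dom   : ∀ x c → l G x c → Item G x

  IsFinite : Graph I 𝒜 → Set
  IsFinite G = Σ (List I) (λ xs → ∀ x → Item G x → x ∈ xs)
             × (∀ x → Σ (List ∣ 𝒜 ∣) (λ cs → ∀ c → l G x c → c ∈ cs))

  -- H ◁ G  (same algebra is enforced by the type)
  record _◁_ (H G : Graph I 𝒜) : Set where
    field
      V⊆   : ∀ x → V H x → V G x
      A⊆   : ∀ a → A H a → A G a
      src= : ∀ a v → src H a v ⇔ (A H a × src G a v)
      tgt= : ∀ a v → tgt H a v ⇔ (A H a × tgt G a v)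
      l⊆   : ∀ x → Item H x → ∀ c → l H x c → l G x c

  Joinable : Graph I 𝒜 → Graph I 𝒜 → Set
  Joinable H G = (∀ x → V H x → A G x → ⊥)
               × (∀ x → A H x → V G x → ⊥)
               × (∀ a → A H a → A G a → ∀ v → src H a v ⇔ src G a v)
               × (∀ a → A H a → A G a → ∀ v → tgt H a v ⇔ tgt G a v)

  _⊓_ : Graph I 𝒜 → Graph I 𝒜 → Graph I 𝒜
  H ⊓ G = record
    { V   = λ x → V H x × V G x
    ; A   = λ a → A H a × A G a
    ; src = λ a v → (A H a × A G a) × src H a v
    ; tgt = λ a v → (A H a × A G a) × tgt H a v
    ; l   = λ x c → l H x c × l G x c
    }

  _⊔_ : Graph I 𝒜 → Graph I 𝒜 → Graph I 𝒜
  H ⊔ G = record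
    { V   = λ x → V H x ⊎ V G x
    ; A   = λ a → A H a ⊎ A G a
    ; src = λ a v → (A H a × src H a v) ⊎ (A G a × src G a v)
    ; tgt = λ a v → (A H a × tgt H a v) ⊎ (A G a × tgt G a v)
    ; l   = λ x c → (Item H x × l H x c) ⊎ (Item G x × l G x c)
    }

record Morphism {𝕊 : Sig} {I J : Set} {𝒜 ℬ : Algebra 𝕊}
                (H : Graph I 𝒜) (G : Graph J ℬ) : Set where
  field
    f    : I → J
    hom  : Hom 𝒜 ℬ
    pV   : ∀ x → V H x → V G (f x)
    pA   : ∀ a → A H a → A G (f a)
    psrc : ∀ a v → A H a → src H a v → src G (f a) (f v)
    ptgt : ∀ a v → A H a → tgt H a v → tgt G (f a) (f v)
    pl   : ∀ x → Item H x → ∀ c → l H x c → l G (f x) (homU hom c)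
open Morphism public

module _ {𝕊 : Sig} {I J : Set} {𝒜 ℬ : Algebra 𝕊}
         {H : Graph I 𝒜} {G : Graph J ℬ} where

  IsMatching : Morphism H G → Set
  IsMatching α = ∀ x y → Item H x → Item H y → f α x ≡ f α y → x ≡ y

  -- α(F): the smallest subgraph of G such that α restricted to F is a
  -- morphism F → α(F)
  image : Morphism H G → Graph I 𝒜 → Graph J ℬ
  image α F = record
    { V   = λ y → Σ I (λ x → V F x × f α x ≡ y)
    ; A   = λ b → Σ I (λ a → A F a × f α a ≡ b)
    ; src = λ b w → Σ I (λ a → A F a × f α a ≡ b) × src G b w
    ; tgt = λ b w → Σ I (λ a → A F a × f α a ≡ b) × tgt G b w
    ; l   = λ y c → Σ I (λ x → Item F x × f α x ≡ y ×
                      Σ ∣ 𝒜 ∣ (λ t → l F x t × homU (hom α) t ≡ c))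
    }

record Rule (𝕊 : Sig) (I : Set) : Set₁ where
  field
    X      : Var 𝕊 → Bool
    L K R  : Graph I (TermAlg 𝕊 X)
    L-gr   : IsAttrGraph L
    K-gr   : IsAttrGraph K
    R-gr   : IsAttrGraph R
    L-fin  : IsFinite L
    K-fin  : IsFinite K
    R-fin  : IsFinite R
    X-fin  : Σ (List (Var 𝕊)) (λ vs → ∀ v → X v ≡ true → v ∈ vs)
    LR-joinable : Joinable L R
    L⊓R◁K  : (L ⊓ R) ◁ K
    K◁L    : K ◁ L
    X-def  : ∀ v → (X v ≡ true) ⇔
               Σ I (λ x → Item L x × Σ ∣ TermAlg 𝕊 X ∣ (λ c → l L x c × v ∈ vars (proj₂ c)))
open Rule public

record RuleSet (𝕊 : Sig) (I : Set) : Set₁ where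
  field
    size  : ℕ
    rule  : Fin size → Rule 𝕊 I
    distinct : ∀ i j → i ≢ j →
               ¬ (∀ x → Item (L (rule i)) x ⇔ Item (L (rule j)) x)
open RuleSet public

module _ {𝕊 : Sig} {I J : Set} {𝒜 : Algebra 𝕊} where

  record RMatching (r : Rule 𝕊 I) (G : Graph J 𝒜) : Set where
    field
      mor        : Morphism (L r) G
      injective  : IsMatching mor
      consistent : ∀ x → Item (K r) x → ∀ t t' →
                   l (L r) x t → ¬ l (K r) x t → l (K r) x t' →
                   homU (hom mor) t ≢ homU (hom mor) t'
  open RMatching public

  Match : RuleSet 𝕊 I → Graph J 𝒜 → Set
  Match 𝓡 G = Σ (Fin (size 𝓡)) (λ i → RMatching (rule 𝓡 i) G)

  module _ {𝓡 : RuleSet 𝕊 I} {G : Graph J 𝒜} where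

    ruleOf : Match 𝓡 G → Rule 𝕊 I
    ruleOf (i , _) = rule 𝓡 i

    morOf : (μ : Match 𝓡 G) → Morphism (L (ruleOf μ)) G
    morOf (i , m) = mor m

    -- ambient universe of items: items of G plus fresh items (x , μ)
    Univ : Set
    Univ = J ⊎ (I × Match 𝓡 G)

    lift : Graph J 𝒜 → Graph Univ 𝒜
    lift H = record
      { V   = λ { (inj₁ x) → V H x ; (inj₂ _) → ⊥ }
      ; A   = λ { (inj₁ x) → A H x ; (inj₂ _) → ⊥ }
      ; src = λ { (inj₁ a) (inj₁ v) → src H a v ; _ _ → ⊥ }
      ; tgt = λ { (inj₁ a) (inj₁ v) → tgt H a v ; _ _ → ⊥ }
      ; l   = λ { (inj₁ x) c → l H x c ; (inj₂ _) _ → ⊥ }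
      }

    -- Up μ x y : μ↑(x) = y  (for x an item of R_μ)
    Up : Match 𝓡 G → I → Univ → Set
    Up μ x y = (Item (K (ruleOf μ)) x × y ≡ inj₁ (f (morOf μ) x))
             ⊎ (¬ Item (K (ruleOf μ)) x × y ≡ inj₂ (x , μ))

    up : Match 𝓡 G → Graph Univ 𝒜
    up μ = record
      { V   = λ y → Σ I (λ x → V Rμ x × Up μ x y)
      ; A   = λ b → Σ I (λ a → A Rμ a × Up μ a b)
      ; src = λ b w → Σ I (λ a → Σ I (λ v → A Rμ a × Up μ a b × src Rμ a v × Up μ v w))
      ; tgt = λ b w → Σ I (λ a → Σ I (λ v → A Rμ a × Up μ a b × tgt Rμ a v × Up μ v w))
      ; l   = λ y c → Σ I (λ x → Item Rμ x × Up μ x y ×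
                        Σ ∣ TermAlg 𝕊 (X (ruleOf μ)) ∣
                          (λ t → l Rμ x t × homU (hom (morOf μ)) t ≡ c))
      }
      where Rμ = R (ruleOf μ)

    imL imK imRK : Match 𝓡 G → Graph J 𝒜
    imL μ  = image (morOf μ) (L (ruleOf μ))
    imK μ  = image (morOf μ) (K (ruleOf μ))
    imRK μ = image (morOf μ) (R (ruleOf μ) ⊓ K (ruleOf μ))

  ParallelIndependent : (𝓡 : RuleSet 𝕊 I) (G : Graph J 𝒜) → (Match 𝓡 G → Set) → Set
  ParallelIndependent 𝓡 G M =
    ∀ μ ν → M μ → M ν → μ ≢ ν →
    ((lift' (imL' ν) ⊔ up' ν) ⊓ lift' (imL' μ)) ◁ (lift' (imK' μ) ⊔ up' μ)
    where
      lift' = lift {𝓡 = 𝓡} {G = G}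
      up'   = up {𝓡 = 𝓡} {G = G}
      imL'  = imL {𝓡 = 𝓡} {G = G}
      imK'  = imK {𝓡 = 𝓡} {G = G}

  ParallelCoherent : (𝓡 : RuleSet 𝕊 I) (G : Graph J 𝒜) → (Match 𝓡 G → Set) → Set
  ParallelCoherent 𝓡 G M =
    ∀ μ ν → M μ → M ν → (imRK {𝓡 = 𝓡} {G = G} ν ⊓ imL {𝓡 = 𝓡} {G = G} μ)
      ◁ imK {𝓡 = 𝓡} {G = G} μ

module Submission where

open import Defs
open import Data.Product using (Σ; _×_; _,_; proj₁; proj₂)
open import Relation.Nullary using (¬_)

open import Data.Bool using (Bool; true; false)
open import Data.Empty using (⊥; ⊥-elim)
open import Data.Fin using (Fin; zero; suc)
open import Data.List using (List; []; _∷_)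
open import Data.List.Membership.Propositional using (_∈_)
open import Data.List.Relation.Unary.All using ([])
open import Data.List.Relation.Unary.Any using (here)
open import Data.Sum using (inj₁; inj₂)
open import Data.Unit using (⊤; tt)
open import Function using (_∘_)
open import Function.Bundles using (_⇔_; mk⇔; Equivalence)
open import Relation.Binary.PropositionalEquality using (_≡_; _≢_; refl; sym; trans)

-- A rule may delete a value and add back a syntactically different term that the
-- algebra of the host graph identifies with it.  Let G be a single vertex over the
-- one-element algebra, relabel the rule replacing the constant c by d at its vertex,
-- and preserve the rule keeping c.  Since c and d evaluate alike in G, every matching
-- adds back all of its image μ(L) that it deletes, so the set of all matchings is
-- parallel independent; yet the image μ(R ⊓ K) of preserve contains the value c,
-- which relabel does not keep in its μ(K), so the set is not parallel coherent.

module _ {𝕊 : Sig} {I : Set} {𝒜 : Algebra 𝕊} where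

  record Arrowless (F : Graph I 𝒜) : Set where
    constructor arrowless
    field
      noArrow : ∀ a → ¬ A F a
      noSrc   : ∀ a v → ¬ src F a v
      noTgt   : ∀ a v → ¬ tgt F a v

  arrowless-◁ : {F H : Graph I 𝒜} → Arrowless F →
                (∀ x → V F x → V H x) →
                (∀ x → Item F x → ∀ c → l F x c → l H x c) → F ◁ H
  arrowless-◁ (arrowless noA noSrc noTgt) V⊆ l⊆ = record
    { V⊆   = V⊆
    ; A⊆   = λ a → ⊥-elim ∘ noA a
    ; src= = λ a v → mk⇔ (⊥-elim ∘ noSrc a v) (⊥-elim ∘ noA a ∘ proj₁)
    ; tgt= = λ a v → mk⇔ (⊥-elim ∘ noTgt a v) (⊥-elim ∘ noA a ∘ proj₁)
    ; l⊆   = l⊆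
    }

  ⊓-arrowlessʳ : {F H : Graph I 𝒜} → Arrowless H → Arrowless (F ⊓ H)
  ⊓-arrowlessʳ (arrowless noA _ _) =
    arrowless (λ a → noA a ∘ proj₂) (λ a v → noA a ∘ proj₂ ∘ proj₁) (λ a v → noA a ∘ proj₂ ∘ proj₁)

  arrowless-joinable : {F H : Graph I 𝒜} → Arrowless F → Arrowless H → Joinable F H
  arrowless-joinable (arrowless noAF _ _) (arrowless noAH _ _) =
    (λ x _ → noAH x) , (λ x → ⊥-elim ∘ noAF x) , (λ a → ⊥-elim ∘ noAF a) , (λ a → ⊥-elim ∘ noAF a)

module _ {𝕊 : Sig} {I J : Set} {𝒜 ℬ : Algebra 𝕊} where

  image-arrowless : {H : Graph I 𝒜} {G : Graph J ℬ} (α : Morphism H G) {F : Graph I 𝒜} →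
                    Arrowless F → Arrowless (image α F)
  image-arrowless α (arrowless noA _ _) = arrowless
    (λ { _ (a , Aa , _) → noA a Aa })
    (λ { _ _ ((a , Aa , _) , _) → noA a Aa })
    (λ { _ _ ((a , Aa , _) , _) → noA a Aa })

module _ {𝕊 : Sig} {I J : Set} {𝒜 : Algebra 𝕊} {𝓡 : RuleSet 𝕊 I} {G : Graph J 𝒜} where

  lift-arrowless : {H : Graph J 𝒜} → Arrowless H → Arrowless (lift {𝓡 = 𝓡} {G = G} H)
  lift-arrowless (arrowless noA noSrc noTgt) = arrowless
    (λ { (inj₁ a) → noA a ; (inj₂ _) () })
    (λ { (inj₁ a) (inj₁ v) → noSrc a v ; (inj₁ _) (inj₂ _) () ; (inj₂ _) _ () })
    (λ { (inj₁ a) (inj₁ v) → noTgt a v ; (inj₁ _) (inj₂ _) () ; (inj₂ _) _ () })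

-- The algebra is an explicit parameter: it cannot be inferred through ∣_∣.
module Point {𝕊 : Sig} {I : Set} (𝒜 : Algebra 𝕊) where

  point : I → (∣ 𝒜 ∣ → Set) → Graph I 𝒜
  point i P = record
    { V = _≡ i ; A = λ _ → ⊥ ; src = λ _ _ → ⊥ ; tgt = λ _ _ → ⊥ ; l = λ x c → x ≡ i × P c }

  module _ {i : I} where

    point-arrowless : {P : ∣ 𝒜 ∣ → Set} → Arrowless (point i P)
    point-arrowless = arrowless (λ _ ()) (λ _ _ ()) (λ _ _ ())

    point-isAttrGraph : {P : ∣ 𝒜 ∣ → Set} → IsAttrGraph (point i P)
    point-isAttrGraph = record
      { VA-disj = λ _ _ ()
      ; src-dom = λ _ _ ()
      ; src-tot = λ _ ()
      ; src-fun = λ _ _ _ ()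
      ; tgt-dom = λ _ _ ()
      ; tgt-tot = λ _ ()
      ; tgt-fun = λ _ _ _ ()
      ; l-dom   = λ _ _ → inj₁ ∘ proj₁
      }

    point-isFinite : {P : ∣ 𝒜 ∣ → Set} (cs : List ∣ 𝒜 ∣) → (∀ c → P c → c ∈ cs) →
                     IsFinite (point i P)
    point-isFinite cs P⊆cs =
      (i ∷ [] , λ { _ (inj₁ refl) → here refl }) , λ _ → cs , λ c → P⊆cs c ∘ proj₂

    point-◁ : {P Q : ∣ 𝒜 ∣ → Set} → (∀ c → P c → Q c) → point i P ◁ point i Q
    point-◁ P⊆Q = arrowless-◁ point-arrowless (λ _ x≡i → x≡i)
                    (λ _ _ c (x≡i , p) → x≡i , P⊆Q c p)

    point-⊓-◁ : {P Q S : ∣ 𝒜 ∣ → Set} → (∀ c → P c → Q c → S c) →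
                (point i P ⊓ point i Q) ◁ point i S
    point-⊓-◁ PQ⊆S = arrowless-◁ (⊓-arrowlessʳ point-arrowless) (λ _ → proj₁)
                       (λ _ _ c ((x≡i , p) , (_ , q)) → x≡i , PQ⊆S c p q)

  point-carriers-differ : {i j : I} (P Q : ∣ 𝒜 ∣ → Set) → i ≢ j →
                          ¬ (∀ x → Item (point i P) x ⇔ Item (point j Q) x)
  point-carriers-differ _ _ i≢j same with Equivalence.to (same _) (inj₁ refl)
  ... | inj₁ i≡j = i≢j i≡j

  point-isMatching : {J : Set} {ℬ : Algebra 𝕊} {G : Graph J ℬ} {i : I} {P : ∣ 𝒜 ∣ → Set}
                     (α : Morphism (point i P) G) → IsMatching α
  point-isMatching α x y (inj₁ x≡i) (inj₁ y≡i) _ = trans x≡i (sym y≡i)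

twoConstants : Sig
twoConstants = record
  { Sort = ⊤ ; Op = Bool ; arity = λ _ → [] ; res = λ _ → tt ; Var = ⊥ ; vsort = λ () }

noVars : Var twoConstants → Bool
noVars ()

Closed : Algebra twoConstants
Closed = TermAlg twoConstants noVars

open Point {I = Bool} Closed

c d : ∣ Closed ∣
c = tt , op false []
d = tt , op true []

c≢d : c ≢ d
c≢d ()

Is-c Is-d Nothing : ∣ Closed ∣ → Set
Is-c t = t ≡ c
Is-d t = t ≡ d
Nothing _ = ⊥

only-c : ∀ t → Is-c t → t ∈ c ∷ []
only-c t refl = here refl

only-d : ∀ t → Is-d t → t ∈ d ∷ []
only-d t refl = here refl

pointRule : (i : Bool) (PL PK PR : ∣ Closed ∣ → Set) (csL csK csR : List ∣ Closed ∣) →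
            (∀ t → PL t → t ∈ csL) → (∀ t → PK t → t ∈ csK) → (∀ t → PR t → t ∈ csR) →
            (∀ t → PL t → PR t → PK t) → (∀ t → PK t → PL t) → Rule twoConstants Bool
pointRule i PL PK PR csL csK csR PL-fin PK-fin PR-fin PL∩PR⊆PK PK⊆PL = record
  { X     = noVars
  ; L     = point i PL
  ; K     = point i PK
  ; R     = point i PR
  ; L-gr  = point-isAttrGraph
  ; K-gr  = point-isAttrGraph
  ; R-gr  = point-isAttrGraph
  ; L-fin = point-isFinite csL PL-fin
  ; K-fin = point-isFinite csK PK-fin
  ; R-fin = point-isFinite csR PR-fin
  ; X-fin = [] , λ ()
  ; LR-joinable = arrowless-joinable {F = point i PL} {H = point i PR} point-arrowless point-arrowless
  ; L⊓R◁K = point-⊓-◁ PL∩PR⊆PK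
  ; K◁L   = point-◁ PK⊆PL
  ; X-def = λ ()
  }

relabel preserve : Rule twoConstants Bool
relabel  = pointRule false Is-c Nothing Is-d (c ∷ []) [] (d ∷ []) only-c (λ _ ()) only-d
             (λ _ t≡c t≡d → c≢d (trans (sym t≡c) t≡d)) (λ _ ())
preserve = pointRule true Is-c Is-c Is-c (c ∷ []) (c ∷ []) (c ∷ []) only-c only-c only-c
             (λ _ t≡c _ → t≡c) (λ _ t≡c → t≡c)

rules : RuleSet twoConstants Bool
rules = record { size = 2 ; rule = ruleAt ; distinct = lhs-differ }
  where
  ruleAt : Fin 2 → Rule twoConstants Bool
  ruleAt zero       = relabel
  ruleAt (suc zero) = preserve

  lhs-differ : ∀ i j → i ≢ j → ¬ (∀ x → Item (L (ruleAt i)) x ⇔ Item (L (ruleAt j)) x)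
  lhs-differ zero       zero       i≢i = ⊥-elim (i≢i refl)
  lhs-differ zero       (suc zero) _   = point-carriers-differ Is-c Is-c λ ()
  lhs-differ (suc zero) zero       _   = point-carriers-differ Is-c Is-c λ ()
  lhs-differ (suc zero) (suc zero) i≢i = ⊥-elim (i≢i refl)

Trivial : Algebra twoConstants
Trivial = record { Carrier = λ _ → ⊤ ; apply = λ _ _ → tt }

G : Graph ⊤ Trivial
G = Point.point Trivial tt λ _ → ⊤

toG : {H : Graph Bool Closed} → Arrowless H → Morphism H G
toG (arrowless noA _ _) = record
  { f    = λ _ → tt
  ; hom  = record { fun = λ _ → tt ; pres = λ _ _ → refl }
  ; pV   = λ _ _ → refl
  ; pA   = λ a → ⊥-elim ∘ noA a
  ; psrc = λ a _ → ⊥-elim ∘ noA a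
  ; ptgt = λ a _ → ⊥-elim ∘ noA a
  ; pl   = λ _ _ _ _ → refl , tt
  }

Matchings : Set
Matchings = Match rules G

relabelMatch preserveMatch : Matchings
relabelMatch = zero , record
  { mor = α ; injective = point-isMatching α ; consistent = λ { _ _ _ _ _ _ (_ , ()) } }
  where α : Morphism (L relabel) G
        α = toG point-arrowless
preserveMatch = suc zero , record
  { mor = α ; injective = point-isMatching α ; consistent = λ _ _ _ _ lt ¬kt _ _ → ¬kt lt }
  where α : Morphism (L preserve) G
        α = toG point-arrowless

rule-L-arrowless : (μ : Matchings) → Arrowless (L (ruleOf {𝓡 = rules} μ))
rule-L-arrowless (zero     , _) = point-arrowless
rule-L-arrowless (suc zero , _) = point-arrowless

imK-vertex : (μ : Matchings) → V (imK {𝓡 = rules} μ) tt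
imK-vertex (zero     , _) = false , refl , refl
imK-vertex (suc zero , _) = true  , refl , refl

-- relabel deletes c but re-adds d, which G's algebra identifies with c.
value-survives : (μ : Matchings) →
                 l (lift {𝓡 = rules} {G = G} (imK {𝓡 = rules} μ) ⊔ up {𝓡 = rules} μ) (inj₁ tt) (tt , tt)
value-survives (zero , _) =
  inj₂ ( inj₁ (false , refl , inj₁ (inj₁ refl , refl))
       , (false , inj₁ refl , inj₁ (inj₁ refl , refl) , (d , (refl , refl) , refl)) )
value-survives (suc zero , _) =
  inj₁ (inj₁ (true , refl , refl) , (true , inj₁ refl , refl , (c , (refl , refl) , refl)))

allMatchings-independent : ParallelIndependent rules G λ _ → ⊤
allMatchings-independent μ ν _ _ _ =
  arrowless-◁ (⊓-arrowlessʳ (lift-arrowless (image-arrowless (morOf {𝓡 = rules} μ) (rule-L-arrowless μ))))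
    (λ { (inj₁ tt) _ → inj₁ (imK-vertex μ) ; (inj₂ _) (_ , ()) })
    (λ { (inj₁ tt) _ _ _ → value-survives μ ; (inj₂ _) _ _ (_ , ()) })

relabel-imK-unattributed : ∀ t → ¬ l (imK {𝓡 = rules} relabelMatch) tt t
relabel-imK-unattributed _ (_ , _ , _ , _ , (_ , ()) , _)

c-preserved-and-matched :
  l (imRK {𝓡 = rules} preserveMatch ⊓ imL {𝓡 = rules} relabelMatch) tt (tt , tt)
c-preserved-and-matched =
    (true , inj₁ (refl , refl) , refl , (c , ((refl , refl) , (refl , refl)) , refl))
  , (false , inj₁ refl , refl , (c , (refl , refl) , refl))

allMatchings-incoherent : ¬ ParallelCoherent rules G λ _ → ⊤
allMatchings-incoherent coherent =
  relabel-imK-unattributed (tt , tt)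
    (_◁_.l⊆ (coherent relabelMatch preserveMatch tt tt) tt
      (inj₁ ((true , (refl , refl) , refl) , (false , refl , refl)))
      (tt , tt) c-preserved-and-matched)

proposition2 : Σ Sig (λ 𝕊 → Σ Set (λ I → Σ (RuleSet 𝕊 I) (λ 𝓡 →
    Σ Set (λ J → Σ (Algebra 𝕊) (λ 𝒜 → Σ (Graph J 𝒜) (λ G →
    IsAttrGraph G × Σ (Match 𝓡 G → Set) (λ M →
    ParallelIndependent 𝓡 G M × ¬ ParallelCoherent 𝓡 G M)))))))
proposition2 = twoConstants , Bool , rules , ⊤ , Trivial , G , Point.point-isAttrGraph Trivial
             , (λ _ → ⊤) , allMatchings-independent , allMatchings-incoherent
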